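{- Let $\mathcal{M}$ and $\mathcal{A}$ be two disjoint antichains in $2^{[n]}$, $[n]=\{1,\ldots,n\}$, with $[n]\notin\mathcal{M}$. Suppose that for every $A\in\mathcal{A}$ there is a unique $f(A)\in\mathcal{M}$ with $A\subset f(A)$. Then $$\sum_{M\in\mathcal{M}}\binom{n}{|M|}^{ -1}+\sum_{A\in\mathcal{A}}\frac{1}{2}\binom{n}{|A|}^{ -1}\leq 1,$$ with equality only when $|A|=n-2$ and $|f(A)|=n-1$ for each $A\in\mathcal{A}$.
   Context: An antichain is a family of sets no two distinct members of which are comparable under inclusion. -}

module Defs where

open import Data.Nat using (ℕ; zero; suc; _*_)
open import Data.Nat.Combinatorics using (_C_)
open import Data.Integer using (+_)
open import Data.Rational using (ℚ; _/_; _+_; 0ℚ)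
open import Data.List using (List; []; _∷_)
open import Data.List.Membership.Propositional using (_∈_)
open import Data.Fin.Subset using (Subset; _⊆_; ∣_∣)
open import Relation.Binary.PropositionalEquality using (_≡_)

-- A family of subsets of [n] is a duplicate-free list (see Statement: Unique).
Family : ℕ → Set
Family n = List (Subset n)

IsAntichain : ∀ {n} → Family n → Set
IsAntichain F = ∀ {X Y} → X ∈ F → Y ∈ F → X ⊆ Y → X ≡ Y

-- Reciprocal of a natural number as a rational (only used on positive
-- arguments: binomials n C k with k ≤ n; value at 0 is an arbitrary 0).
recip : ℕ → ℚ
recip zero = 0ℚ
recip (suc m) = + 1 / suc m

lymSum : ∀ {n} → (Subset n → ℚ) → Family n → ℚ
lymSum w [] = 0ℚ
lymSum w (X ∷ F) = w X + lymSum w F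

invBinom : ∀ n → Subset n → ℚ
invBinom n X = recip (n C ∣ X ∣)

halfInvBinom : ∀ n → Subset n → ℚ
halfInvBinom n X = recip (2 * (n C ∣ X ∣))

{-# OPTIONS --safe #-}
module Submission where

-- Lubell's chain counting. Of the n! maximal chains, h(X) = |X|! (n − |X|)! pass through X,
-- and a chain meets an antichain at most once. Hence the pairs (X, chain through X) with X in
-- 𝓜 or 𝓐 number at most n! + L, where L counts those pairs with X = A ∈ 𝓐 whose chain also
-- meets 𝓜. The member of 𝓜 on such a chain is comparable with A, so it is f(A); and as
-- |A| < |f(A)| < n, at most h(A) / (n − |A|) ≤ h(A) / 2 chains pass through both A and f(A).
-- So ∑_𝓜 h + ½ ∑_𝓐 h ≤ n!, the claimed inequality times n!; equality forces n − |A| = 2.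

module ChainCounting where

  open import Defs using (Family; IsAntichain)
  open import Level using (Level)
  open import Data.Bool using (Bool; true; false; _∧_; T)
  open import Data.Bool.Properties using (T-≡; T-∧; ∧-identityʳ; ∧-zeroʳ; ∧-idem; ∧-commutativeMonoid)
  open import Data.Nat using (ℕ; zero; suc; _+_; _*_; _∸_; _≤_; _<_; _≤ᵇ_; z≤n; s≤s; s≤s⁻¹; _!; >-nonZero)
  open import Data.Nat.Properties
  open import Data.Nat.ListAction using (sum)
  open import Data.Nat.ListAction.Properties using (sum-++)
  open import Data.List using (List; []; _∷_; [_]; _++_; map; downFrom; cartesianProductWith)
  open import Data.List.Properties using (map-++; map-∘)
  open import Data.List.Membership.Propositional using (_∈_; _∉_)
  open import Data.List.Relation.Unary.Any using (here; there)
  open import Data.List.Relation.Unary.All as All using ()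
  open import Data.List.Relation.Unary.AllPairs using (_∷_)
  open import Data.List.Relation.Unary.Unique.Propositional using (Unique)
  open import Data.Vec using (Vec; []; _∷_; here)
  open import Data.Fin.Subset using (Subset; _⊆_; _⊂_; ⊤; ∣_∣; outside; inside)
  open import Data.Fin.Subset.Properties
    using (∣p∣≤n; ∣p∣≡n⇒p≡⊤; p⊆q⇒∣p∣≤∣q∣; p⊂q⇒∣p∣<∣q∣; drop-∷-⊆; ⊆-refl; ⊆-trans)
  open import Data.Fin.Subset.Properties using (out⊆; s⊆s; out⊂; out⊂in; s⊂s)
  open import Data.Product using (_×_; _,_; proj₁; proj₂; ∃-syntax)
  open import Data.Sum using (_⊎_; inj₁; inj₂)
  open import Algebra.Bundles using (CommutativeMonoid)
  open import Algebra.Properties.CommutativeSemigroup +-commutativeSemigroup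
    using () renaming (interchange to +-interchange)
  open import Algebra.Properties.CommutativeSemigroup *-commutativeSemigroup
    using () renaming (x∙yz≈y∙xz to x*yz≡y*xz)
  open import Algebra.Properties.CommutativeSemigroup (CommutativeMonoid.commutativeSemigroup ∧-commutativeMonoid)
    using () renaming (interchange to ∧-interchange)
  open import Function using (_∘_; Equivalence)
  open import Relation.Nullary using (¬_; yes; no; contradiction)
  open import Relation.Nullary.Reflects using (ofʸ)
  open import Relation.Binary.PropositionalEquality
    using (_≡_; _≢_; refl; sym; trans; cong; cong₂; subst; module ≡-Reasoning)

  private variable
    ℓ₁ ℓ₂ ℓ₃ : Level
    A : Set ℓ₁
    B : Set ℓ₂
    C : Set ℓ₃

  ∑ : List A → (A → ℕ) → ℕ
  ∑ xs f = sum (map f xs)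

  syntax ∑ xs (λ x → e) = ∑[ x ∈ xs ] e

  module _ {f g : A → ℕ} where

    ∑-cong : ∀ xs → (∀ x → f x ≡ g x) → ∑ xs f ≡ ∑ xs g
    ∑-cong []       f≗g = refl
    ∑-cong (x ∷ xs) f≗g = cong₂ _+_ (f≗g x) (∑-cong xs f≗g)

    ∑-mono-≤ : ∀ xs → (∀ {x} → x ∈ xs → f x ≤ g x) → ∑ xs f ≤ ∑ xs g
    ∑-mono-≤ []       f≤g = z≤n
    ∑-mono-≤ (x ∷ xs) f≤g = +-mono-≤ (f≤g (here refl)) (∑-mono-≤ xs (f≤g ∘ there))

    ∑-+ : ∀ xs → ∑[ x ∈ xs ] (f x + g x) ≡ ∑ xs f + ∑ xs g
    ∑-+ []       = refl
    ∑-+ (x ∷ xs) =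
      trans (cong (f x + g x +_) (∑-+ xs)) (+-interchange (f x) (g x) (∑ xs f) (∑ xs g))

    ∑-tight : ∀ xs → (∀ {x} → x ∈ xs → f x ≤ g x) → ∑ xs g ≤ ∑ xs f →
              ∀ {x} → x ∈ xs → g x ≤ f x
    ∑-tight (y ∷ xs) f≤g ∑g≤∑f (here refl) = +-cancelʳ-≤ (∑ xs g) (g y) (f y)
      (≤-trans ∑g≤∑f (+-monoʳ-≤ (f y) (∑-mono-≤ xs (f≤g ∘ there))))
    ∑-tight (y ∷ xs) f≤g ∑g≤∑f (there x∈xs) = ∑-tight xs (f≤g ∘ there) ∑g≤∑f-tail x∈xs
      where
      ∑g≤∑f-tail : ∑ xs g ≤ ∑ xs f
      ∑g≤∑f-tail = +-cancelˡ-≤ (g y) (∑ xs g) (∑ xs f) (≤-trans ∑g≤∑f (+-monoˡ-≤ (∑ xs f) (f≤g (here refl))))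

  module _ (f : A → ℕ) (k : ℕ) where

    ∑-*ˡ : ∀ xs → ∑[ x ∈ xs ] (k * f x) ≡ k * ∑ xs f
    ∑-*ˡ []       = sym (*-zeroʳ k)
    ∑-*ˡ (x ∷ xs) = trans (cong (k * f x +_) (∑-*ˡ xs)) (sym (*-distribˡ-+ k (f x) (∑ xs f)))

    ∑-*ʳ : ∀ xs → ∑[ x ∈ xs ] (f x * k) ≡ ∑ xs f * k
    ∑-*ʳ []       = refl
    ∑-*ʳ (x ∷ xs) = trans (cong (f x * k +_) (∑-*ʳ xs)) (sym (*-distribʳ-+ k (f x) (∑ xs f)))

  ∑-zero : (xs : List A) → ∑[ x ∈ xs ] 0 ≡ 0
  ∑-zero []       = refl
  ∑-zero (x ∷ xs) = ∑-zero xs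

  ∑-comm : (xs : List A) (ys : List B) (g : A → B → ℕ) →
           ∑[ x ∈ xs ] ∑[ y ∈ ys ] g x y ≡ ∑[ y ∈ ys ] ∑[ x ∈ xs ] g x y
  ∑-comm []       ys g = sym (∑-zero ys)
  ∑-comm (x ∷ xs) ys g = trans (cong (∑ ys (g x) +_) (∑-comm xs ys g)) (sym (∑-+ ys))

  ∑-++ : (xs ys : List A) (f : A → ℕ) → ∑ (xs ++ ys) f ≡ ∑ xs f + ∑ ys f
  ∑-++ xs ys f = trans (cong sum (map-++ f xs ys)) (sum-++ (map f xs) (map f ys))

  ∑-map : (h : A → B) (xs : List A) (f : B → ℕ) → ∑ (map h xs) f ≡ ∑ xs (f ∘ h)
  ∑-map h xs f = cong sum (sym (map-∘ xs))

  ∑-cartesianProductWith : (h : A → B → C) (xs : List A) (ys : List B) (f : C → ℕ) →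
    ∑ (cartesianProductWith h xs ys) f ≡ ∑[ x ∈ xs ] ∑[ y ∈ ys ] f (h x y)
  ∑-cartesianProductWith h []       ys f = refl
  ∑-cartesianProductWith h (x ∷ xs) ys f =
    trans (∑-++ (map (h x) ys) _ f) (cong₂ _+_ (∑-map (h x) ys f) (∑-cartesianProductWith h xs ys f))

  𝟙 : Bool → ℕ
  𝟙 true  = 1
  𝟙 false = 0

  𝟙-∧ : ∀ x y → 𝟙 (x ∧ y) ≡ 𝟙 x * 𝟙 y
  𝟙-∧ true  y = sym (+-identityʳ (𝟙 y))
  𝟙-∧ false y = refl

  module _ (p : A → Bool) where

    ∑-𝟙≡0 : ∀ xs → (∀ {x} → x ∈ xs → ¬ T (p x)) → ∑[ x ∈ xs ] 𝟙 (p x) ≡ 0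
    ∑-𝟙≡0 []       _  = refl
    ∑-𝟙≡0 (x ∷ xs) ¬p with p x in px
    ... | true  = contradiction (Equivalence.from T-≡ px) (¬p (here refl))
    ... | false = ∑-𝟙≡0 xs (¬p ∘ there)

    ∑-𝟙≤1 : ∀ {xs} → Unique xs → (∀ {x y} → x ∈ xs → y ∈ xs → T (p x) → T (p y) → x ≡ y) →
            ∑[ x ∈ xs ] 𝟙 (p x) ≤ 1
    ∑-𝟙≤1 {[]}     _               _    = z≤n
    ∑-𝟙≤1 {x ∷ xs} (x≢xs ∷ unique) same with p x in px
    ... | false = ∑-𝟙≤1 unique (λ x∈xs y∈xs → same (there x∈xs) (there y∈xs))
    ... | true  = s≤s (≤-reflexive (∑-𝟙≡0 xs λ y∈xs py →
      All.lookup x≢xs y∈xs (same (here refl) (there y∈xs) (Equivalence.from T-≡ px) py)))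

  ≤⇒≤ᵇ≡true : ∀ {m n} → m ≤ n → (m ≤ᵇ n) ≡ true
  ≤⇒≤ᵇ≡true m≤n = Equivalence.to T-≡ (≤⇒≤ᵇ m≤n)

  >⇒≤ᵇ≡false : ∀ {m n} → n < m → (m ≤ᵇ n) ≡ false
  >⇒≤ᵇ≡false {m} {n} n<m with m ≤ᵇ n | ≤ᵇ-reflects-≤ m n
  ... | false | _       = refl
  ... | true  | ofʸ m≤n = contradiction m≤n (<⇒≱ n<m)

  count-≥ : ∀ N lo → ∑[ t ∈ downFrom N ] 𝟙 (lo ≤ᵇ t) ≡ N ∸ lo
  count-≥ zero    lo = sym (0∸n≡0 lo)
  count-≥ (suc N) lo with lo ≤? N
  ... | yes lo≤N rewrite ≤⇒≤ᵇ≡true lo≤N | count-≥ N lo = sym (+-∸-assoc 1 lo≤N)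
  ... | no  lo≰N rewrite >⇒≤ᵇ≡false (≰⇒> lo≰N) | count-≥ N lo =
    trans (m≤n⇒m∸n≡0 (<⇒≤ (≰⇒> lo≰N))) (sym (m≤n⇒m∸n≡0 (≰⇒> lo≰N)))

  between+above≡from : ∀ {lo hi} t → lo ≤ suc hi →
    𝟙 ((lo ≤ᵇ t) ∧ (t ≤ᵇ hi)) + 𝟙 (suc hi ≤ᵇ t) ≡ 𝟙 (lo ≤ᵇ t)
  between+above≡from {lo} {hi} t lo≤1+hi with t ≤? hi
  ... | yes t≤hi rewrite ≤⇒≤ᵇ≡true t≤hi | >⇒≤ᵇ≡false (s≤s t≤hi) =
    trans (+-identityʳ _) (cong 𝟙 (∧-identityʳ (lo ≤ᵇ t)))
  ... | no  t≰hi rewrite >⇒≤ᵇ≡false (≰⇒> t≰hi) | ≤⇒≤ᵇ≡true (≰⇒> t≰hi)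
                       | ≤⇒≤ᵇ≡true (≤-trans lo≤1+hi (≰⇒> t≰hi)) = refl

  ∸-split : ∀ {a b c} → a ≤ b → b ≤ c → c ∸ a ≡ (b ∸ a) + (c ∸ b)
  ∸-split {a} {b} {c} a≤b b≤c = begin
    c ∸ a             ≡⟨ cong (_∸ a) (m∸n+n≡m b≤c) ⟨
    (c ∸ b) + b ∸ a   ≡⟨ +-∸-assoc (c ∸ b) a≤b ⟩
    (c ∸ b) + (b ∸ a) ≡⟨ +-comm (c ∸ b) (b ∸ a) ⟩
    (b ∸ a) + (c ∸ b) ∎
    where open ≡-Reasoning

  count-between : ∀ N {lo hi} → lo ≤ suc hi → hi < N →
    ∑[ t ∈ downFrom N ] 𝟙 ((lo ≤ᵇ t) ∧ (t ≤ᵇ hi)) ≡ suc hi ∸ lo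
  count-between N {lo} {hi} lo≤1+hi hi<N = +-cancelʳ-≡ (N ∸ suc hi) between (suc hi ∸ lo) (begin
    between + (N ∸ suc hi)
      ≡⟨ cong (between +_) (count-≥ N (suc hi)) ⟨
    between + ∑[ t ∈ downFrom N ] 𝟙 (suc hi ≤ᵇ t)
      ≡⟨ ∑-+ (downFrom N) ⟨
    ∑[ t ∈ downFrom N ] (𝟙 ((lo ≤ᵇ t) ∧ (t ≤ᵇ hi)) + 𝟙 (suc hi ≤ᵇ t))
      ≡⟨ ∑-cong (downFrom N) (λ t → between+above≡from t lo≤1+hi) ⟩
    ∑[ t ∈ downFrom N ] 𝟙 (lo ≤ᵇ t)
      ≡⟨ count-≥ N lo ⟩
    N ∸ lo
      ≡⟨ ∸-split lo≤1+hi hi<N ⟩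
    (suc hi ∸ lo) + (N ∸ suc hi) ∎)
    where
    open ≡-Reasoning
    between : ℕ
    between = ∑[ t ∈ downFrom N ] 𝟙 ((lo ≤ᵇ t) ∧ (t ≤ᵇ hi))

  -- Maximal chains

  -- A maximal chain is the sequence of initial segments of an ordering of [n]. The code t ∷ c
  -- of an ordering of [1 + n] orders the points 1, …, n as c does and puts the point 0 right
  -- after the first t of them (0 ≤ t ≤ n). So x ∷ X is on the chain iff X is on c and, when
  -- x holds, t ≤ |X|, and otherwise |X| ≤ t.
  Chain : ℕ → Set
  Chain = Vec ℕ

  chains : ∀ n → List (Chain n)
  chains zero    = [ [] ]
  chains (suc n) = cartesianProductWith _∷_ (downFrom (suc n)) (chains n)

  fits : Bool → ℕ → ℕ → Bool
  fits false t a = a ≤ᵇ t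
  fits true  t a = t ≤ᵇ a

  through : ∀ {n} → Chain n → Subset n → Bool
  through []      []      = true
  through (t ∷ c) (x ∷ X) = fits x t ∣ X ∣ ∧ through c X

  ∑-chains-∷ : ∀ n (f : Chain (suc n) → ℕ) (h : ℕ → ℕ) (g : Chain n → ℕ) →
    (∀ t c → f (t ∷ c) ≡ h t * g c) → ∑ (chains (suc n)) f ≡ ∑ (downFrom (suc n)) h * ∑ (chains n) g
  ∑-chains-∷ n f h g f≡h*g = begin
    ∑ (chains (suc n)) f
      ≡⟨ ∑-cartesianProductWith _∷_ (downFrom (suc n)) (chains n) f ⟩
    ∑[ t ∈ downFrom (suc n) ] ∑[ c ∈ chains n ] f (t ∷ c)
      ≡⟨ ∑-cong (downFrom (suc n)) (λ t → ∑-cong (chains n) (f≡h*g t)) ⟩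
    ∑[ t ∈ downFrom (suc n) ] ∑[ c ∈ chains n ] (h t * g c)
      ≡⟨ ∑-cong (downFrom (suc n)) (λ t → ∑-*ˡ g (h t) (chains n)) ⟩
    ∑[ t ∈ downFrom (suc n) ] (h t * ∑ (chains n) g)
      ≡⟨ ∑-*ʳ h (∑ (chains n) g) (downFrom (suc n)) ⟩
    ∑ (downFrom (suc n)) h * ∑ (chains n) g ∎
    where open ≡-Reasoning

  #chains : ∀ n → ∑[ c ∈ chains n ] 1 ≡ n !
  #chains zero    = refl
  #chains (suc n) = trans (∑-chains-∷ n (λ _ → 1) (λ _ → 1) (λ _ → 1) (λ _ _ → refl))
                          (cong₂ _*_ (count-≥ (suc n) 0) (#chains n))

  T-∧-split : ∀ {x y} → T (x ∧ y) → T x × T y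
  T-∧-split = Equivalence.to T-∧

  through-⊆ : ∀ {n} (c : Chain n) {X Y : Subset n} →
    T (through c X) → T (through c Y) → ∣ X ∣ ≤ ∣ Y ∣ → X ⊆ Y
  through-⊆ (t ∷ c) {false ∷ X} {false ∷ Y} cxX cyY ∣X∣≤∣Y∣
    with _ , cX ← T-∧-split cxX | _ , cY ← T-∧-split cyY
    = out⊆ (through-⊆ c cX cY ∣X∣≤∣Y∣)
  through-⊆ (t ∷ c) {false ∷ X} {true ∷ Y} cxX cyY _
    with ∣X∣≤t , cX ← T-∧-split cxX | t≤∣Y∣ , cY ← T-∧-split cyY
    = out⊆ (through-⊆ c cX cY (≤-trans (≤ᵇ⇒≤ _ _ ∣X∣≤t) (≤ᵇ⇒≤ _ _ t≤∣Y∣)))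
  through-⊆ (t ∷ c) {true ∷ X} {true ∷ Y} cxX cyY (s≤s ∣X∣≤∣Y∣)
    with _ , cX ← T-∧-split cxX | _ , cY ← T-∧-split cyY
    = s⊆s (through-⊆ c cX cY ∣X∣≤∣Y∣)
  through-⊆ (t ∷ c) {true ∷ X} {false ∷ Y} cxX cyY ∣X∣<∣Y∣
    with t≤∣X∣ , _ ← T-∧-split cxX | ∣Y∣≤t , _ ← T-∧-split cyY
    = contradiction (≤-trans (≤ᵇ⇒≤ _ _ ∣Y∣≤t) (≤ᵇ⇒≤ _ _ t≤∣X∣)) (<⇒≱ ∣X∣<∣Y∣)

  through-comparable : ∀ {n} (c : Chain n) {X Y : Subset n} →
    T (through c X) → T (through c Y) → X ⊆ Y ⊎ Y ⊆ X
  through-comparable c {X} {Y} cX cY with ≤-total ∣ X ∣ ∣ Y ∣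
  ... | inj₁ ∣X∣≤∣Y∣ = inj₁ (through-⊆ c cX cY ∣X∣≤∣Y∣)
  ... | inj₂ ∣Y∣≤∣X∣ = inj₂ (through-⊆ c cY cX ∣Y∣≤∣X∣)

  #through : ∀ {n} → Subset n → ℕ
  #through {n} X = ∑[ c ∈ chains n ] 𝟙 (through c X)

  #through₂ : ∀ {n} → Subset n → Subset n → ℕ
  #through₂ {n} X Y = ∑[ c ∈ chains n ] 𝟙 (through c X ∧ through c Y)

  insertions : ℕ → Bool → Bool → ℕ → ℕ → ℕ
  insertions n x y a m = ∑[ t ∈ downFrom (suc n) ] 𝟙 (fits x t a ∧ fits y t m)

  #through₂-∷ : ∀ {n} x y (X Y : Subset n) →
    #through₂ (x ∷ X) (y ∷ Y) ≡ insertions n x y (∣ X ∣) (∣ Y ∣) * #through₂ X Y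
  #through₂-∷ {n} x y X Y =
    ∑-chains-∷ n _ (λ t → 𝟙 (fits x t ∣ X ∣ ∧ fits y t ∣ Y ∣)) (λ c → 𝟙 (through c X ∧ through c Y))
      λ t c → trans (cong 𝟙 (∧-interchange (fits x t ∣ X ∣) (through c X) (fits y t ∣ Y ∣) (through c Y)))
                    (𝟙-∧ (fits x t ∣ X ∣ ∧ fits y t ∣ Y ∣) (through c X ∧ through c Y))

  ≤ᵇ∧≤ᵇ-lower : ∀ {a m} t → a ≤ m → (a ≤ᵇ t) ∧ (m ≤ᵇ t) ≡ (m ≤ᵇ t)
  ≤ᵇ∧≤ᵇ-lower {a} {m} t a≤m with m ≤? t
  ... | yes m≤t rewrite ≤⇒≤ᵇ≡true m≤t | ≤⇒≤ᵇ≡true (≤-trans a≤m m≤t) = refl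
  ... | no  m≰t rewrite >⇒≤ᵇ≡false (≰⇒> m≰t) = ∧-zeroʳ (a ≤ᵇ t)

  ≤ᵇ∧≤ᵇ-upper : ∀ {a m} t → a ≤ m → (t ≤ᵇ a) ∧ (t ≤ᵇ m) ≡ (t ≤ᵇ a)
  ≤ᵇ∧≤ᵇ-upper {a} {m} t a≤m with t ≤? a
  ... | yes t≤a rewrite ≤⇒≤ᵇ≡true t≤a | ≤⇒≤ᵇ≡true (≤-trans t≤a a≤m) = refl
  ... | no  t≰a rewrite >⇒≤ᵇ≡false (≰⇒> t≰a) = refl

  [1+m∸n]! : ∀ {m n} → n ≤ m → (suc m ∸ n) ! ≡ (suc m ∸ n) * (m ∸ n) !
  [1+m∸n]! n≤m rewrite +-∸-assoc 1 n≤m = refl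

  insertions-* : ∀ {n} x y {X Y : Subset n} → (x ∷ X) ⊆ (y ∷ Y) →
    insertions n x y (∣ X ∣) (∣ Y ∣) * (∣ X ∣ ! * (∣ Y ∣ ∸ ∣ X ∣) ! * (n ∸ ∣ Y ∣) !)
      ≡ ∣ x ∷ X ∣ ! * (∣ y ∷ Y ∣ ∸ ∣ x ∷ X ∣) ! * (suc n ∸ ∣ y ∷ Y ∣) !
  insertions-* {n} false false {X} {Y} xX⊆yY = begin
    insertions n false false a m * (a ! * (m ∸ a) ! * (n ∸ m) !)
      ≡⟨ cong (_* (a ! * (m ∸ a) ! * (n ∸ m) !)) (trans
           (∑-cong (downFrom (suc n)) (λ t → cong 𝟙 (≤ᵇ∧≤ᵇ-lower t a≤m)))
           (count-≥ (suc n) m)) ⟩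
    (suc n ∸ m) * (a ! * (m ∸ a) ! * (n ∸ m) !)
      ≡⟨ x*yz≡y*xz (suc n ∸ m) (a ! * (m ∸ a) !) ((n ∸ m) !) ⟩
    a ! * (m ∸ a) ! * ((suc n ∸ m) * (n ∸ m) !)
      ≡⟨ cong (a ! * (m ∸ a) ! *_) ([1+m∸n]! (∣p∣≤n Y)) ⟨
    a ! * (m ∸ a) ! * (suc n ∸ m) ! ∎
    where
    open ≡-Reasoning
    a m : ℕ
    a = ∣ X ∣
    m = ∣ Y ∣
    a≤m : a ≤ m
    a≤m = p⊆q⇒∣p∣≤∣q∣ (drop-∷-⊆ xX⊆yY)
  insertions-* {n} false true {X} {Y} xX⊆yY = begin
    insertions n false true a m * (a ! * (m ∸ a) ! * (n ∸ m) !)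
      ≡⟨ cong (_* (a ! * (m ∸ a) ! * (n ∸ m) !))
              (count-between (suc n) (≤-trans a≤m (n≤1+n m)) (s≤s (∣p∣≤n Y))) ⟩
    (suc m ∸ a) * (a ! * (m ∸ a) ! * (n ∸ m) !)
      ≡⟨ *-assoc (suc m ∸ a) (a ! * (m ∸ a) !) ((n ∸ m) !) ⟨
    (suc m ∸ a) * (a ! * (m ∸ a) !) * (n ∸ m) !
      ≡⟨ cong (_* (n ∸ m) !) (x*yz≡y*xz (suc m ∸ a) (a !) ((m ∸ a) !)) ⟩
    a ! * ((suc m ∸ a) * (m ∸ a) !) * (n ∸ m) !
      ≡⟨ cong (λ k → a ! * k * (n ∸ m) !) ([1+m∸n]! a≤m) ⟨
    a ! * (suc m ∸ a) ! * (n ∸ m) ! ∎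
    where
    open ≡-Reasoning
    a m : ℕ
    a = ∣ X ∣
    m = ∣ Y ∣
    a≤m : a ≤ m
    a≤m = p⊆q⇒∣p∣≤∣q∣ (drop-∷-⊆ xX⊆yY)
  -- (0 ≤ᵇ t) ∧ b computes to b, so count-between with lo = 0 counts the t ≤ a.
  insertions-* {n} true true {X} {Y} xX⊆yY = begin
    insertions n true true a m * (a ! * (m ∸ a) ! * (n ∸ m) !)
      ≡⟨ cong (_* (a ! * (m ∸ a) ! * (n ∸ m) !)) (trans
           (∑-cong (downFrom (suc n)) (λ t → cong 𝟙 (≤ᵇ∧≤ᵇ-upper t a≤m)))
           (count-between (suc n) z≤n (s≤s (≤-trans a≤m (∣p∣≤n Y))))) ⟩
    suc a * (a ! * (m ∸ a) ! * (n ∸ m) !)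
      ≡⟨ *-assoc (suc a) (a ! * (m ∸ a) !) ((n ∸ m) !) ⟨
    suc a * (a ! * (m ∸ a) !) * (n ∸ m) !
      ≡⟨ cong (_* (n ∸ m) !) (*-assoc (suc a) (a !) ((m ∸ a) !)) ⟨
    suc a * a ! * (m ∸ a) ! * (n ∸ m) ! ∎
    where
    open ≡-Reasoning
    a m : ℕ
    a = ∣ X ∣
    m = ∣ Y ∣
    a≤m : a ≤ m
    a≤m = p⊆q⇒∣p∣≤∣q∣ (drop-∷-⊆ xX⊆yY)
  insertions-* true false xX⊆yY = contradiction (xX⊆yY here) λ ()

  #through₂-≡ : ∀ {n} {X Y : Subset n} → X ⊆ Y →
    #through₂ X Y ≡ ∣ X ∣ ! * (∣ Y ∣ ∸ ∣ X ∣) ! * (n ∸ ∣ Y ∣) !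
  #through₂-≡ {zero}  {[]}    {[]}    _     = refl
  #through₂-≡ {suc n} {x ∷ X} {y ∷ Y} xX⊆yY = begin
    #through₂ (x ∷ X) (y ∷ Y)
      ≡⟨ #through₂-∷ x y X Y ⟩
    insertions n x y (∣ X ∣) (∣ Y ∣) * #through₂ X Y
      ≡⟨ cong (insertions n x y (∣ X ∣) (∣ Y ∣) *_) (#through₂-≡ (drop-∷-⊆ xX⊆yY)) ⟩
    insertions n x y (∣ X ∣) (∣ Y ∣) * (∣ X ∣ ! * (∣ Y ∣ ∸ ∣ X ∣) ! * (n ∸ ∣ Y ∣) !)
      ≡⟨ insertions-* x y xX⊆yY ⟩
    ∣ x ∷ X ∣ ! * (∣ y ∷ Y ∣ ∸ ∣ x ∷ X ∣) ! * (suc n ∸ ∣ y ∷ Y ∣) ! ∎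
    where open ≡-Reasoning

  #through₂>0 : ∀ {n} {X Y : Subset n} → X ⊆ Y → 0 < #through₂ X Y
  #through₂>0 {n} {X} {Y} X⊆Y = subst (0 <_) (sym (#through₂-≡ X⊆Y))
    (*-mono-≤ (*-mono-≤ (1≤n! ∣ X ∣) (1≤n! (∣ Y ∣ ∸ ∣ X ∣))) (1≤n! (n ∸ ∣ Y ∣)))

  #through-≡ : ∀ {n} (X : Subset n) → #through X ≡ ∣ X ∣ ! * (n ∸ ∣ X ∣) !
  #through-≡ {n} X = begin
    #through X
      ≡⟨ ∑-cong (chains n) (λ c → cong 𝟙 (∧-idem (through c X))) ⟨
    #through₂ X X
      ≡⟨ #through₂-≡ {X = X} ⊆-refl ⟩
    ∣ X ∣ ! * (∣ X ∣ ∸ ∣ X ∣) ! * (n ∸ ∣ X ∣) !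
      ≡⟨ cong (λ k → ∣ X ∣ ! * k ! * (n ∸ ∣ X ∣) !) (n∸n≡0 ∣ X ∣) ⟩
    ∣ X ∣ ! * 1 * (n ∸ ∣ X ∣) !
      ≡⟨ cong (_* (n ∸ ∣ X ∣) !) (*-identityʳ (∣ X ∣ !)) ⟩
    ∣ X ∣ ! * (n ∸ ∣ X ∣) ! ∎
    where open ≡-Reasoning

  [1+k]!*[1+l]!≤[1+k+l]! : ∀ k l → (suc k) ! * (suc l) ! ≤ (suc k + l) !
  [1+k]!*[1+l]!≤[1+k+l]! k zero    =
    ≤-reflexive (trans (*-identityʳ ((suc k) !)) (cong _! (sym (+-identityʳ (suc k)))))
  [1+k]!*[1+l]!≤[1+k+l]! k (suc l) = begin
    (suc k) ! * (suc (suc l)) !            ≡⟨ x*yz≡y*xz ((suc k) !) (suc (suc l)) ((suc l) !) ⟩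
    suc (suc l) * ((suc k) ! * (suc l) !)  ≤⟨ *-monoʳ-≤ (suc (suc l)) ([1+k]!*[1+l]!≤[1+k+l]! k l) ⟩
    suc (suc l) * (suc k + l) !            ≤⟨ *-monoˡ-≤ ((suc k + l) !) (s≤s (s≤s (m≤n+m l k))) ⟩
    suc (suc k + l) * (suc k + l) !        ≡⟨ cong _! (+-suc (suc k) l) ⟨
    (suc k + suc l) !                      ∎
    where open ≤-Reasoning

  [k+l]*k!*l!≤[k+l]! : ∀ {k l} → 1 ≤ k → 1 ≤ l → (k + l) * (k ! * l !) ≤ (k + l) !
  [k+l]*k!*l!≤[k+l]! {suc k} {suc l} _ _ = *-monoʳ-≤ (suc k + suc l)
    (≤-trans ([1+k]!*[1+l]!≤[1+k+l]! k l) (≤-reflexive (cong _! (sym (+-suc k l)))))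

  2≤n∸a : ∀ {a m n} → a < m → m < n → 2 ≤ n ∸ a
  2≤n∸a a<m m<n = ≤-trans (+-mono-≤ (m<n⇒0<n∸m a<m) (m<n⇒0<n∸m m<n))
                          (≤-reflexive (sym (∸-split (<⇒≤ a<m) (<⇒≤ m<n))))

  #through₂-≤ : ∀ {n} {A M : Subset n} → A ⊂ M → ∣ M ∣ < n → (n ∸ ∣ A ∣) * #through₂ A M ≤ #through A
  #through₂-≤ {n} {A} {M} A⊂M m<n = begin
    (n ∸ a) * #through₂ A M
      ≡⟨ cong ((n ∸ a) *_) (#through₂-≡ (proj₁ A⊂M)) ⟩
    (n ∸ a) * (a ! * (m ∸ a) ! * (n ∸ m) !)
      ≡⟨ cong ((n ∸ a) *_) (*-assoc (a !) ((m ∸ a) !) ((n ∸ m) !)) ⟩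
    (n ∸ a) * (a ! * ((m ∸ a) ! * (n ∸ m) !))
      ≡⟨ x*yz≡y*xz (n ∸ a) (a !) ((m ∸ a) ! * (n ∸ m) !) ⟩
    a ! * ((n ∸ a) * ((m ∸ a) ! * (n ∸ m) !))
      ≡⟨ cong (λ k → a ! * (k * ((m ∸ a) ! * (n ∸ m) !))) n∸a≡ ⟩
    a ! * ((m ∸ a + (n ∸ m)) * ((m ∸ a) ! * (n ∸ m) !))
      ≤⟨ *-monoʳ-≤ (a !) ([k+l]*k!*l!≤[k+l]! (m<n⇒0<n∸m a<m) (m<n⇒0<n∸m m<n)) ⟩
    a ! * (m ∸ a + (n ∸ m)) !
      ≡⟨ cong (λ k → a ! * k !) n∸a≡ ⟨
    a ! * (n ∸ a) !
      ≡⟨ #through-≡ A ⟨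
    #through A ∎
    where
    open ≤-Reasoning
    a m : ℕ
    a = ∣ A ∣
    m = ∣ M ∣
    a<m : a < m
    a<m = p⊂q⇒∣p∣<∣q∣ A⊂M
    n∸a≡ : n ∸ a ≡ m ∸ a + (n ∸ m)
    n∸a≡ = ∸-split (<⇒≤ a<m) (<⇒≤ m<n)

  hits : ∀ {n} → Chain n → Family n → ℕ
  hits c F = ∑[ X ∈ F ] 𝟙 (through c X)

  hits≤1 : ∀ {n} (c : Chain n) {F : Family n} → Unique F → IsAntichain F → hits c F ≤ 1
  hits≤1 c {F} unique antichain = ∑-𝟙≤1 (λ X → through c X) unique same
    where
    same : ∀ {X Y} → X ∈ F → Y ∈ F → T (through c X) → T (through c Y) → X ≡ Y
    same X∈F Y∈F cX cY with through-comparable c cX cY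
    ... | inj₁ X⊆Y = antichain X∈F Y∈F X⊆Y
    ... | inj₂ Y⊆X = sym (antichain Y∈F X∈F Y⊆X)

  totalHits : ∀ {n} → Family n → ℕ
  totalHits F = ∑[ X ∈ F ] #through X

  ∑-hits : ∀ {n} (F : Family n) → ∑[ c ∈ chains n ] hits c F ≡ totalHits F
  ∑-hits {n} F = ∑-comm (chains n) F (λ c X → 𝟙 (through c X))

  #throughMeeting : ∀ {n} → Subset n → Family n → ℕ
  #throughMeeting {n} Y F = ∑[ c ∈ chains n ] (𝟙 (through c Y) * hits c F)

  m+n≤1+n*m : ∀ {m n} → m ≤ 1 → n ≤ 1 → m + n ≤ 1 + n * m
  m+n≤1+n*m {zero}  {zero}  _         _         = z≤n
  m+n≤1+n*m {zero}  {suc _} _         (s≤s z≤n) = s≤s z≤n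
  m+n≤1+n*m {suc _} {zero}  (s≤s z≤n) _         = s≤s z≤n
  m+n≤1+n*m {suc _} {suc _} (s≤s z≤n) (s≤s z≤n) = s≤s (s≤s z≤n)

  totalHits-antichains : ∀ {n} {F G : Family n} →
    Unique F → IsAntichain F → Unique G → IsAntichain G →
    totalHits F + totalHits G ≤ n ! + ∑[ Y ∈ G ] #throughMeeting Y F
  totalHits-antichains {n} {F} {G} uniqueF antichainF uniqueG antichainG = begin
    totalHits F + totalHits G
      ≡⟨ cong₂ _+_ (∑-hits F) (∑-hits G) ⟨
    ∑[ c ∈ chains n ] hits c F + ∑[ c ∈ chains n ] hits c G
      ≡⟨ ∑-+ (chains n) ⟨
    ∑[ c ∈ chains n ] (hits c F + hits c G)
      ≤⟨ ∑-mono-≤ (chains n) (λ {c} _ →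
           m+n≤1+n*m (hits≤1 c uniqueF antichainF) (hits≤1 c uniqueG antichainG)) ⟩
    ∑[ c ∈ chains n ] (1 + hits c G * hits c F)
      ≡⟨ ∑-+ (chains n) ⟩
    ∑[ c ∈ chains n ] 1 + ∑[ c ∈ chains n ] (hits c G * hits c F)
      ≡⟨ cong₂ _+_ (#chains n) (∑-cong (chains n) λ c →
           sym (∑-*ʳ (λ Y → 𝟙 (through c Y)) (hits c F) G)) ⟩
    n ! + ∑[ c ∈ chains n ] ∑[ Y ∈ G ] (𝟙 (through c Y) * hits c F)
      ≡⟨ cong (n ! +_) (∑-comm (chains n) G (λ c Y → 𝟙 (through c Y) * hits c F)) ⟩
    n ! + ∑[ Y ∈ G ] #throughMeeting Y F ∎
    where open ≤-Reasoning

  ⊆∧≢⇒⊂ : ∀ {n} {X Y : Subset n} → X ⊆ Y → X ≢ Y → X ⊂ Y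
  ⊆∧≢⇒⊂ {X = []}          {[]}          _     X≢Y = contradiction refl X≢Y
  ⊆∧≢⇒⊂ {X = outside ∷ X} {outside ∷ Y} xX⊆yY X≢Y =
    out⊂ (⊆∧≢⇒⊂ (drop-∷-⊆ xX⊆yY) (X≢Y ∘ cong (outside ∷_)))
  ⊆∧≢⇒⊂ {X = outside ∷ X} {inside  ∷ Y} xX⊆yY _   = out⊂in (drop-∷-⊆ xX⊆yY)
  ⊆∧≢⇒⊂ {X = inside  ∷ X} {outside ∷ Y} xX⊆yY _   = contradiction (xX⊆yY here) λ ()
  ⊆∧≢⇒⊂ {X = inside  ∷ X} {inside  ∷ Y} xX⊆yY X≢Y =
    s⊂s (⊆∧≢⇒⊂ (drop-∷-⊆ xX⊆yY) (X≢Y ∘ cong (inside ∷_)))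

  module _ {n} {𝓜 : Family n} (unique : Unique 𝓜) (antichain : IsAntichain 𝓜)
           {A M : Subset n} (A∉𝓜 : A ∉ 𝓜) (M∈𝓜 : M ∈ 𝓜) (A⊂M : A ⊂ M)
           (only-M : ∀ {M′} → M′ ∈ 𝓜 → A ⊂ M′ → M′ ≡ M) where

    on-chain⇒≡M : (c : Chain n) → T (through c A) → ∀ {Y} → Y ∈ 𝓜 → T (through c Y) → Y ≡ M
    on-chain⇒≡M c cA {Y} Y∈𝓜 cY with through-comparable c cA cY
    ... | inj₁ A⊆Y = only-M Y∈𝓜 (⊆∧≢⇒⊂ A⊆Y λ A≡Y → A∉𝓜 (subst (_∈ 𝓜) (sym A≡Y) Y∈𝓜))
    ... | inj₂ Y⊆A = antichain Y∈𝓜 M∈𝓜 (⊆-trans Y⊆A (proj₁ A⊂M))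

    #throughMeeting≤#through₂ : #throughMeeting A 𝓜 ≤ #through₂ A M
    #throughMeeting≤#through₂ = ∑-mono-≤ (chains n) (λ {c} _ → pointwise c)
      where
      pointwise : ∀ c → 𝟙 (through c A) * hits c 𝓜 ≤ 𝟙 (through c A ∧ through c M)
      pointwise c with through c A in cA | through c M in cM
      ... | false | _     = z≤n
      ... | true  | true  = ≤-trans (≤-reflexive (+-identityʳ (hits c 𝓜))) (hits≤1 c unique antichain)
      ... | true  | false =
        ≤-reflexive (trans (+-identityʳ (hits c 𝓜)) (∑-𝟙≡0 (λ X → through c X) 𝓜 off-chain))
        where
        off-chain : ∀ {Y} → Y ∈ 𝓜 → ¬ T (through c Y)
        off-chain Y∈𝓜 cY with refl ← on-chain⇒≡M c (Equivalence.from T-≡ cA) Y∈𝓜 cY =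
          contradiction (trans (sym cM) (Equivalence.to T-≡ cY)) λ ()

  n∸a≤2⇒a≡n∸2×m≡n∸1 : ∀ {a m n} → a < m → m < n → n ∸ a ≤ 2 → a ≡ n ∸ 2 × m ≡ n ∸ 1
  n∸a≤2⇒a≡n∸2×m≡n∸1 {a} {m} {n} a<m m<n n∸a≤2 = go n≡2+a
    where
    n≡2+a : n ≡ 2 + a
    n≡2+a = trans (sym (m∸n+n≡m (≤-trans (n≤1+n a) (≤-trans a<m (<⇒≤ m<n)))))
                  (cong (_+ a) (≤-antisym n∸a≤2 (2≤n∸a a<m m<n)))
    go : n ≡ 2 + a → a ≡ n ∸ 2 × m ≡ n ∸ 1
    go refl = refl , ≤-antisym (s≤s⁻¹ m<n) a<m

  -- The inequality and its equality case, scaled by 2 n!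

  module _ {n} {𝓜 𝓐 : Family n} (unique-𝓜 : Unique 𝓜) (unique-𝓐 : Unique 𝓐)
           (antichain-𝓜 : IsAntichain 𝓜) (antichain-𝓐 : IsAntichain 𝓐)
           (disjoint : ∀ {X} → X ∈ 𝓜 → X ∉ 𝓐) (⊤∉𝓜 : ⊤ ∉ 𝓜)
           (cover : ∀ {A} → A ∈ 𝓐 →
                    ∃[ M ] (M ∈ 𝓜 × A ⊂ M × (∀ {M′} → M′ ∈ 𝓜 → A ⊂ M′ → M′ ≡ M))) where

    private
      ∑meeting : ℕ
      ∑meeting = ∑[ A ∈ 𝓐 ] #throughMeeting A 𝓜

    ∣M∣<n : ∀ {M} → M ∈ 𝓜 → ∣ M ∣ < n
    ∣M∣<n {M} M∈𝓜 = ≤∧≢⇒< (∣p∣≤n M) λ ∣M∣≡n → ⊤∉𝓜 (subst (_∈ 𝓜) (∣p∣≡n⇒p≡⊤ ∣M∣≡n) M∈𝓜)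

    meeting≤through₂ : ∀ {A M} → A ∈ 𝓐 → M ∈ 𝓜 → A ⊂ M → #throughMeeting A 𝓜 ≤ #through₂ A M
    meeting≤through₂ {A} {M} A∈𝓐 M∈𝓜 A⊂M with cover A∈𝓐
    ... | _ , _ , _ , only-f =
      #throughMeeting≤#through₂ unique-𝓜 antichain-𝓜 (λ A∈𝓜 → disjoint A∈𝓜 A∈𝓐) M∈𝓜 A⊂M
        (λ M′∈𝓜 A⊂M′ → trans (only-f M′∈𝓜 A⊂M′) (sym (only-f M∈𝓜 A⊂M)))

    2*meeting≤through : ∀ {A} → A ∈ 𝓐 → 2 * #throughMeeting A 𝓜 ≤ #through A
    2*meeting≤through {A} A∈𝓐 with cover A∈𝓐
    ... | M , M∈𝓜 , A⊂M , _ = begin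
      2 * #throughMeeting A 𝓜
        ≤⟨ *-monoʳ-≤ 2 (meeting≤through₂ A∈𝓐 M∈𝓜 A⊂M) ⟩
      2 * #through₂ A M
        ≤⟨ *-monoˡ-≤ (#through₂ A M) (2≤n∸a (p⊂q⇒∣p∣<∣q∣ A⊂M) (∣M∣<n M∈𝓜)) ⟩
      (n ∸ ∣ A ∣) * #through₂ A M
        ≤⟨ #through₂-≤ A⊂M (∣M∣<n M∈𝓜) ⟩
      #through A ∎
      where open ≤-Reasoning

    doubled-count : 2 * totalHits 𝓜 + totalHits 𝓐 + totalHits 𝓐 ≤ 2 * n ! + 2 * ∑meeting
    doubled-count = begin
      2 * ∑𝓜 + ∑𝓐 + ∑𝓐        ≡⟨ +-assoc (2 * ∑𝓜) ∑𝓐 ∑𝓐 ⟩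
      2 * ∑𝓜 + (∑𝓐 + ∑𝓐)      ≡⟨ cong (λ k → 2 * ∑𝓜 + (∑𝓐 + k)) (+-identityʳ ∑𝓐) ⟨
      2 * ∑𝓜 + 2 * ∑𝓐         ≡⟨ *-distribˡ-+ 2 ∑𝓜 ∑𝓐 ⟨
      2 * (∑𝓜 + ∑𝓐)           ≤⟨ *-monoʳ-≤ 2 totalHits-𝓜+𝓐 ⟩
      2 * (n ! + ∑meeting)     ≡⟨ *-distribˡ-+ 2 (n !) ∑meeting ⟩
      2 * n ! + 2 * ∑meeting   ∎
      where
      open ≤-Reasoning
      ∑𝓜 ∑𝓐 : ℕ
      ∑𝓜 = totalHits 𝓜
      ∑𝓐 = totalHits 𝓐
      totalHits-𝓜+𝓐 : ∑𝓜 + ∑𝓐 ≤ n ! + ∑meeting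
      totalHits-𝓜+𝓐 = totalHits-antichains unique-𝓜 antichain-𝓜 unique-𝓐 antichain-𝓐

    2*∑meeting≤totalHits : 2 * ∑meeting ≤ totalHits 𝓐
    2*∑meeting≤totalHits = ≤-trans (≤-reflexive (sym (∑-*ˡ (λ A → #throughMeeting A 𝓜) 2 𝓐)))
                                   (∑-mono-≤ 𝓐 2*meeting≤through)

    lym-bound : 2 * totalHits 𝓜 + totalHits 𝓐 ≤ 2 * n !
    lym-bound = +-cancelʳ-≤ (totalHits 𝓐) (2 * totalHits 𝓜 + totalHits 𝓐) (2 * n !) (begin
      2 * totalHits 𝓜 + totalHits 𝓐 + totalHits 𝓐  ≤⟨ doubled-count ⟩
      2 * n ! + 2 * ∑meeting                         ≤⟨ +-monoʳ-≤ (2 * n !) 2*∑meeting≤totalHits ⟩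
      2 * n ! + totalHits 𝓐                          ∎)
      where open ≤-Reasoning

    lym-equality : 2 * totalHits 𝓜 + totalHits 𝓐 ≡ 2 * n ! →
      ∀ {A M} → A ∈ 𝓐 → M ∈ 𝓜 → A ⊂ M → ∣ A ∣ ≡ n ∸ 2 × ∣ M ∣ ≡ n ∸ 1
    lym-equality tight {A} {M} A∈𝓐 M∈𝓜 A⊂M =
      n∸a≤2⇒a≡n∸2×m≡n∸1 (p⊂q⇒∣p∣<∣q∣ A⊂M) (∣M∣<n M∈𝓜)
        (*-cancelʳ-≤ (n ∸ ∣ A ∣) 2 (#through₂ A M) {{>-nonZero (#through₂>0 (proj₁ A⊂M))}} (begin
          (n ∸ ∣ A ∣) * #through₂ A M  ≤⟨ #through₂-≤ A⊂M (∣M∣<n M∈𝓜) ⟩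
          #through A                   ≤⟨ ∑-tight 𝓐 2*meeting≤through through≤2*meeting A∈𝓐 ⟩
          2 * #throughMeeting A 𝓜      ≤⟨ *-monoʳ-≤ 2 (meeting≤through₂ A∈𝓐 M∈𝓜 A⊂M) ⟩
          2 * #through₂ A M            ∎))
      where
      open ≤-Reasoning
      through≤2*meeting : totalHits 𝓐 ≤ ∑[ A ∈ 𝓐 ] (2 * #throughMeeting A 𝓜)
      through≤2*meeting = +-cancelˡ-≤ (2 * totalHits 𝓜 + totalHits 𝓐) _ _ (begin
        2 * totalHits 𝓜 + totalHits 𝓐 + totalHits 𝓐
          ≤⟨ doubled-count ⟩
        2 * n ! + 2 * ∑meeting
          ≡⟨ cong₂ _+_ (sym tight) (sym (∑-*ˡ (λ A → #throughMeeting A 𝓜) 2 𝓐)) ⟩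
        2 * totalHits 𝓜 + totalHits 𝓐 + ∑[ A ∈ 𝓐 ] (2 * #throughMeeting A 𝓜) ∎)

module CommonDenominator where

  open import Defs using (Family; recip; lymSum; invBinom; halfInvBinom)
  open ChainCounting using (∑; ∑-*ˡ; #through; #through-≡; totalHits)
  open import Data.Nat as ℕ using (ℕ; zero; suc; pred; _*_; _∸_; _!; NonZero)
  open import Data.Nat.Properties
    using (≤-trans; ≤-reflexive; *-assoc; *-comm; suc-pred; m*n≢0; _!≢0; _!*_!≢0; *-commutativeSemigroup)
  open import Algebra.Properties.CommutativeSemigroup *-commutativeSemigroup
    using () renaming (x∙yz≈y∙xz to x*yz≡y*xz)
  open import Data.Nat.Combinatorics using (_C_; nCk≡n!/k![n-k]!; k![n∸k]!∣n!)
  open import Data.Nat.DivMod using (m/n*n≡m)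
  open import Data.Integer using (+_; +≤+) renaming (_*_ to _*ℤ_; _≤_ to _≤ℤ_; _+_ to _+ℤ_)
  open import Data.Integer.Properties using (pos-*; pos-+; +-injective)
    renaming (*-identityˡ to *ℤ-identityˡ; *-identityʳ to *ℤ-identityʳ)
  open import Data.Integer.Tactic.RingSolver using (solve-∀)
  open import Data.Rational using (ℚ; _+_; _≤_; 1ℚ; toℚᵘ)
  open import Data.Rational.Properties using (toℚᵘ-fromℚᵘ; toℚᵘ-homo-+; toℚᵘ-cancel-≤)
  open import Data.Rational.Unnormalised using (mkℚᵘ; *≡*; *≤*) renaming (_≃_ to _≃ᵘ_; _+_ to _+ᵘ_)
  open import Data.Rational.Unnormalised.Properties using (≃-trans; ≃-sym; ≃-reflexive; +-cong; ≤-respˡ-≃)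
  open import Data.List using ([]; _∷_)
  open import Data.Fin.Subset using (Subset; ∣_∣)
  open import Data.Fin.Subset.Properties using (∣p∣≤n)
  open import Relation.Binary.PropositionalEquality
    using (_≡_; refl; sym; trans; cong; cong₂; subst₂; module ≡-Reasoning)

  nCk*k!*[n∸k]!≡n! : ∀ {n k} → k ℕ.≤ n → (n C k) * (k ! * (n ∸ k) !) ≡ n !
  nCk*k!*[n∸k]!≡n! {n} {k} k≤n = trans (cong (_* (k ! * (n ∸ k) !)) (nCk≡n!/k![n-k]! k≤n))
                                       (m/n*n≡m {{k !* (n ∸ k) !≢0}} (k![n∸k]!∣n! k≤n))

  C*#through≡n! : ∀ {n} (X : Subset n) → (n C ∣ X ∣) * #through X ≡ n !
  C*#through≡n! {n} X =
    trans (cong ((n C ∣ X ∣) *_) (#through-≡ X)) (nCk*k!*[n∸k]!≡n! (∣p∣≤n X))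

  -- mkℚᵘ (+ k) d is the fraction k / (1 + d).
  module _ {d : ℕ} where

    recip-≃ᵘ : ∀ k {K} → k * K ≡ suc d → toℚᵘ (recip k) ≃ᵘ mkℚᵘ (+ K) d
    recip-≃ᵘ zero    ()
    recip-≃ᵘ (suc k) {K} k*K≡1+d = ≃-trans (toℚᵘ-fromℚᵘ (mkℚᵘ (+ 1) k)) (*≡* (begin
      + 1 *ℤ + suc d  ≡⟨ *ℤ-identityˡ (+ suc d) ⟩
      + suc d         ≡⟨ cong +_ (trans (sym k*K≡1+d) (*-comm (suc k) K)) ⟩
      + (K * suc k)   ≡⟨ pos-* K (suc k) ⟩
      + K *ℤ + suc k  ∎))
      where open ≡-Reasoning

    mkℚᵘ-+ : ∀ a b → mkℚᵘ (+ a) d +ᵘ mkℚᵘ (+ b) d ≃ᵘ mkℚᵘ (+ (a ℕ.+ b)) d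
    mkℚᵘ-+ a b = *≡* (trans (distrib (+ a) (+ b) (+ suc d))
                            (sym (cong₂ _*ℤ_ (pos-+ a b) (pos-* (suc d) (suc d)))))
      where
      distrib : ∀ x y z → (x *ℤ z +ℤ y *ℤ z) *ℤ z ≡ (x +ℤ y) *ℤ (z *ℤ z)
      distrib = solve-∀

    lymSum-≃ᵘ : ∀ {n} {w : Subset n → ℚ} {g : Subset n → ℕ} (F : Family n) →
      (∀ X → toℚᵘ (w X) ≃ᵘ mkℚᵘ (+ g X) d) → toℚᵘ (lymSum w F) ≃ᵘ mkℚᵘ (+ ∑ F g) d
    lymSum-≃ᵘ []                  _   = *≡* refl
    lymSum-≃ᵘ {w = w} {g} (X ∷ F) w≃g = ≃-trans (toℚᵘ-homo-+ (w X) (lymSum w F))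
      (≃-trans (+-cong (w≃g X) (lymSum-≃ᵘ F w≃g)) (mkℚᵘ-+ (g X) (∑ F g)))

    ≃ᵘ-≤1 : ∀ {q : ℚ} {k} → toℚᵘ q ≃ᵘ mkℚᵘ (+ k) d → k ℕ.≤ suc d → q ≤ 1ℚ
    ≃ᵘ-≤1 {k = k} q≃k k≤1+d = toℚᵘ-cancel-≤ (≤-respˡ-≃ (≃-sym q≃k)
      (*≤* (subst₂ _≤ℤ_ (sym (*ℤ-identityʳ (+ k))) (sym (*ℤ-identityˡ (+ suc d))) (+≤+ k≤1+d))))

    ≃ᵘ-≡1 : ∀ {q : ℚ} {k} → toℚᵘ q ≃ᵘ mkℚᵘ (+ k) d → q ≡ 1ℚ → k ≡ suc d
    ≃ᵘ-≡1 {k = k} (*≡* 1*[1+d]≡k*1) refl =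
      +-injective (trans (sym (*ℤ-identityʳ (+ k))) (trans (sym 1*[1+d]≡k*1) (*ℤ-identityˡ (+ suc d))))

  module _ (n : ℕ) (𝓜 𝓐 : Family n) where

    private
      instance
        2*n!≢0 : NonZero (2 * n !)
        2*n!≢0 = m*n≢0 2 (n !) {{_}} {{n !≢0}}

      d : ℕ
      d = pred (2 * n !)

      2*n!≡1+d : 2 * n ! ≡ suc d
      2*n!≡1+d = sym (suc-pred (2 * n !))

    total-≃ᵘ : toℚᵘ (lymSum (invBinom n) 𝓜 + lymSum (halfInvBinom n) 𝓐)
               ≃ᵘ mkℚᵘ (+ (2 * totalHits 𝓜 ℕ.+ totalHits 𝓐)) d
    total-≃ᵘ = ≃-trans (toℚᵘ-homo-+ (lymSum (invBinom n) 𝓜) (lymSum (halfInvBinom n) 𝓐))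
      (≃-trans (+-cong (lymSum-≃ᵘ 𝓜 invBinom-≃ᵘ) (lymSum-≃ᵘ 𝓐 halfInvBinom-≃ᵘ))
      (≃-trans (mkℚᵘ-+ (∑ 𝓜 (λ M → 2 * #through M)) (totalHits 𝓐))
               (≃-reflexive (cong (λ k → mkℚᵘ (+ (k ℕ.+ totalHits 𝓐)) d) (∑-*ˡ #through 2 𝓜)))))
      where
      invBinom-≃ᵘ : ∀ X → toℚᵘ (invBinom n X) ≃ᵘ mkℚᵘ (+ (2 * #through X)) d
      invBinom-≃ᵘ X = recip-≃ᵘ (n C ∣ X ∣) (trans (x*yz≡y*xz (n C ∣ X ∣) 2 (#through X))
                                                (trans (cong (2 *_) (C*#through≡n! X)) 2*n!≡1+d))
      halfInvBinom-≃ᵘ : ∀ X → toℚᵘ (halfInvBinom n X) ≃ᵘ mkℚᵘ (+ #through X) d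
      halfInvBinom-≃ᵘ X = recip-≃ᵘ (2 * (n C ∣ X ∣)) (trans (*-assoc 2 (n C ∣ X ∣) (#through X))
                                                         (trans (cong (2 *_) (C*#through≡n! X)) 2*n!≡1+d))

    total≤1 : 2 * totalHits 𝓜 ℕ.+ totalHits 𝓐 ℕ.≤ 2 * n ! →
              lymSum (invBinom n) 𝓜 + lymSum (halfInvBinom n) 𝓐 ≤ 1ℚ
    total≤1 bound = ≃ᵘ-≤1 total-≃ᵘ (≤-trans bound (≤-reflexive 2*n!≡1+d))

    total≡1 : lymSum (invBinom n) 𝓜 + lymSum (halfInvBinom n) 𝓐 ≡ 1ℚ →
              2 * totalHits 𝓜 ℕ.+ totalHits 𝓐 ≡ 2 * n !
    total≡1 total≡1ℚ = trans (≃ᵘ-≡1 total-≃ᵘ total≡1ℚ) (sym 2*n!≡1+d)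

open import Defs
open import Data.Nat using (ℕ; _∸_)
open import Data.Rational using (ℚ; _+_; _≤_; 1ℚ)
open import Data.Product using (_×_; _,_; ∃-syntax)
open import Data.List.Membership.Propositional using (_∈_; _∉_)
open import Data.List.Relation.Unary.Unique.Propositional using (Unique)
open import Data.Fin.Subset using (Subset; _⊂_; ⊤; ∣_∣)
open import Relation.Binary.PropositionalEquality using (_≡_)
open ChainCounting using (lym-bound; lym-equality)
open CommonDenominator using (total≤1; total≡1)

corollary1 : (n : ℕ) (𝓜 𝓐 : Family n) →
    Unique 𝓜 → Unique 𝓐 →
    IsAntichain 𝓜 → IsAntichain 𝓐 →
    (∀ {X} → X ∈ 𝓜 → X ∉ 𝓐) →
    ⊤ ∉ 𝓜 →
    (∀ {A} → A ∈ 𝓐 → ∃[ M ] (M ∈ 𝓜 × A ⊂ M × (∀ {M′} → M′ ∈ 𝓜 → A ⊂ M′ → M′ ≡ M))) →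
    (lymSum (invBinom n) 𝓜 + lymSum (halfInvBinom n) 𝓐 ≤ 1ℚ)
    × (lymSum (invBinom n) 𝓜 + lymSum (halfInvBinom n) 𝓐 ≡ 1ℚ →
       ∀ {A M} → A ∈ 𝓐 → M ∈ 𝓜 → A ⊂ M → ∣ A ∣ ≡ n ∸ 2 × ∣ M ∣ ≡ n ∸ 1)
corollary1 n 𝓜 𝓐 unique-𝓜 unique-𝓐 antichain-𝓜 antichain-𝓐 disjoint ⊤∉𝓜 cover =
    total≤1 n 𝓜 𝓐 (lym-bound unique-𝓜 unique-𝓐 antichain-𝓜 antichain-𝓐 disjoint ⊤∉𝓜 cover)
  , λ total≡1ℚ →
      lym-equality unique-𝓜 unique-𝓐 antichain-𝓜 antichain-𝓐 disjoint ⊤∉𝓜 cover (total≡1 n 𝓜 𝓐 total≡1ℚ)
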